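{- For all integers $1\leq k\leq n$, the class $\mathcal{G}(n,k)$ of graphs with at most $n$ vertices and maximum degree at most $k$ admits an adjacency labeling scheme of size $\log\binom{n}{\lceil k/2\rceil} + \lceil \log n\rceil + \lceil \log k\rceil$.
   Context: All logarithms are base 2. An adjacency labeling scheme for a class $\mathcal{R}$ of graphs consists of an encoder and a decoder. The encoder receives a graph $G\in\mathcal{R}$ and assigns to each vertex $v\in V(G)$ a binary string (label) $\mathcal{L}(v)$. The decoder receives only two labels $\mathcal{L}(u),\mathcal{L}(v)$ of vertices of the same graph $G$ and must output \textbf{true} if and only if $u$ and $v$ are adjacent in $G$. The size of the scheme is the maximum label length (in bits). -}

module Defs where

open import Data.Nat using (ℕ; _+_; _≤_; _/_)
open import Data.Nat.Combinatorics using (_C_)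
open import Data.Nat.Logarithm using (⌊log₂_⌋; ⌈log₂_⌉)
open import Data.Bool using (Bool; true; false; if_then_else_)
open import Data.Fin using (Fin)
open import Data.List using (List; length; map; allFin)
open import Data.Nat.ListAction using (sum)
open import Data.Product using (Σ; _×_)
open import Relation.Binary.PropositionalEquality using (_≡_)

record Graph (m : ℕ) : Set where
  field
    adj   : Fin m → Fin m → Bool
    sym   : ∀ u v → adj u v ≡ adj v u
    irrefl : ∀ v → adj v v ≡ false
open Graph public

degree : ∀ {m} → Graph m → Fin m → ℕ
degree G v = sum (map (λ u → if adj G v u then 1 else 0) (allFin _))

MaxDegreeAtMost : ∀ {m} → ℕ → Graph m → Set
MaxDegreeAtMost k G = ∀ v → degree G v ≤ k

Label : Set
Label = List Bool

-- Adjacency labeling scheme of size at most s for the class G(n,k) of graphs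
-- with at most n vertices and maximum degree at most k: a single decoder
-- (independent of the graph) and, for each graph in the class, a labeling
-- (the encoder's output) with labels of length ≤ s, such that the decoder
-- outputs true on (L u, L v) iff u and v are adjacent.
HasLabelingScheme : (n k s : ℕ) → Set
HasLabelingScheme n k s =
  Σ (Label → Label → Bool) λ decoder →
    (m : ℕ) → m ≤ n → (G : Graph m) → MaxDegreeAtMost k G →
      Σ (Fin m → Label) λ L →
        (∀ v → length (L v) ≤ s) ×
        (∀ u v → decoder (L u) (L v) ≡ adj G u v)

⌈_/2⌉ : ℕ → ℕ
⌈ k /2⌉ = (k + 1) / 2

-- Since label lengths are integers, "size ≤ log C(n,⌈k/2⌉) + ⌈log n⌉ + ⌈log k⌉"
-- is equivalent to "size ≤ ⌊log C(n,⌈k/2⌉)⌋ + ⌈log n⌉ + ⌈log k⌉".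
schemeSize : ℕ → ℕ → ℕ
schemeSize n k = ⌊log₂ (n C ⌈ k /2⌉) ⌋ + ⌈log₂ n ⌉ + ⌈log₂ k ⌉

module Submission where

-- 1. (module Arcs) Every list of edges has a balanced orientation, in which each
--    vertex has at most one more outgoing than incoming arc: glue the first edge
--    x–y to another edge y–z into x–z, orient the shorter list, and subdivide
--    the arc obtained for x–z at y again; an edge whose endpoint y is isolated
--    in the rest is oriented away from y.
-- 2. The edge list of G (each edge once) has the degrees and adjacencies of G,
--    so its balanced orientation gives every vertex out-degree at most ⌈k/2⌉.
-- 3. The out-row of v (a 0/1-list of length n) then has at most c = ⌈k/2⌉ ones,
--    and all such lists are enumerated explicitly; there are
--    binomSum n c = Σ_{j ≤ c} C(n,j) ≤ (c+1)·C(n,c) of them.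
-- 4. The label of v is the code v + t·n of v and the position t of its out-row,
--    written in bijective base 2; labels of length at most s cover all numbers
--    below 2^(s+1) - 1.  Two vertices are adjacent iff one lies in the out-row
--    of the other, which the decoder reads off the two labels.
-- 5. The count n·binomSum n c < 2^(s+1) for the claimed size s follows from
--    (c+1)·C(n,c) ≤ k·C(n,c) if k ≥ 2; k = 1 needs a separate estimate, and a
--    single vertex needs no label at all.

open import Defs hiding (sym)
open import Algebra.Bundles using (CommutativeMonoid)
open import Data.Bool using (Bool; true; false; if_then_else_; _∧_; _∨_)
open import Data.Bool.Properties
  using (∧-comm; ∨-comm; ∧-zeroʳ; ∨-identityʳ; ∨-commutativeMonoid)
open import Data.Fin using (Fin; zero; suc; toℕ)
open import Data.Fin.Properties using (toℕ<n) renaming (_≟_ to _≟ᶠ_)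
open import Data.List using (List; []; _∷_; _++_; length; map; replicate; allFin)
open import Data.List.Properties using (length-++; length-map; length-replicate; map-tabulate)
open import Data.List.Membership.Propositional using (_∈_)
open import Data.List.Membership.Propositional.Properties using (∈-map⁺; ∈-++⁺ˡ; ∈-++⁺ʳ)
open import Data.List.Relation.Unary.Any using (here; there)
open import Data.List.Relation.Binary.Pointwise using (Pointwise; []; _∷_; ++⁺)
open import Data.Nat
  using ( ℕ; zero; suc; _+_; _*_; _^_; _≤_; _<_; _≡ᵇ_; _<ᵇ_; z≤n; s≤s
        ; NonZero; >-nonZero; _/_; _%_)
  renaming (⌈_/2⌉ to ⌈_/2⌉ᴺ)
open import Data.Nat.Properties
open import Data.Nat.DivMod
  using ( m/n*n≤m; m*n/n≡m; /-monoˡ-≤; m<n*o⇒m/o<n; [m+kn]%n≡m%n; m<n⇒m%n≡m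
        ; +-distrib-/-∣ʳ; m<n⇒m/n≡0)
open import Data.Nat.Divisibility using (divides)
open import Data.Nat.Combinatorics using (_C_; nC1≡n; nCk+nC[k+1]≡[n+1]C[k+1])
open import Data.Nat.ListAction using (sum)
open import Data.Nat.Logarithm
  using (⌊log₂_⌋; ⌈log₂_⌉; ⌊log₂⌋-mono-≤; ⌊log₂[2^n]⌋≡n)
open import Data.Nat.Logarithm.Core using (⌈log2⌉)
open import Data.Nat.Solver using (module +-*-Solver)
open import Data.Product using (∃; ∃₂; _×_; _,_; proj₁; proj₂; swap)
open import Data.Sum using (_⊎_; inj₁; inj₂)
open import Function using (id; _∘_)
open import Induction.WellFounded using (Acc; acc)
open import Relation.Binary.Definitions using (DecidableEquality)
open import Relation.Binary.PropositionalEquality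
open import Relation.Nullary using (does; yes; no)
open import Relation.Nullary.Decidable using (dec-false)
open import Algebra.Properties.CommutativeSemigroup +-commutativeSemigroup
  using (interchange; x∙yz≈y∙xz)
open import Algebra.Properties.CommutativeSemigroup
  (CommutativeMonoid.commutativeSemigroup ∨-commutativeMonoid)
  using () renaming (interchange to ∨-interchange)

ind : Bool → ℕ
ind b = if b then 1 else 0

module Arcs {V : Set} (_≟_ : DecidableEquality V) where

  Arc : Set
  Arc = V × V

  [_≐_] : V → V → ℕ
  [ a ≐ v ] = ind (does (a ≟ v))

  occurrences : {A : Set} → (A → V) → V → List A → ℕ
  occurrences f v []       = 0
  occurrences f v (x ∷ xs) = [ f x ≐ v ] + occurrences f v xs

  occurrences-middle : {A : Set} (f : A → V) (v : V) (P : List A) (x : A) (R : List A) →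
                       occurrences f v (P ++ x ∷ R) ≡ occurrences f v (x ∷ P ++ R)
  occurrences-middle f v []      x R = refl
  occurrences-middle f v (p ∷ P) x R = begin
    [ f p ≐ v ] + occurrences f v (P ++ x ∷ R)
      ≡⟨ cong ([ f p ≐ v ] +_) (occurrences-middle f v P x R) ⟩
    [ f p ≐ v ] + ([ f x ≐ v ] + occurrences f v (P ++ R))
      ≡⟨ x∙yz≈y∙xz [ f p ≐ v ] [ f x ≐ v ] _ ⟩
    [ f x ≐ v ] + ([ f p ≐ v ] + occurrences f v (P ++ R)) ∎
    where open ≡-Reasoning

  outdeg indeg : V → List Arc → ℕ
  outdeg = occurrences proj₁
  indeg  = occurrences proj₂

  touches : V → Arc → ℕ
  touches v (a , b) = [ a ≐ v ] + [ b ≐ v ]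

  deg : V → List Arc → ℕ
  deg v []      = 0
  deg v (d ∷ D) = touches v d + deg v D

  deg≡outdeg+indeg : ∀ v D → deg v D ≡ outdeg v D + indeg v D
  deg≡outdeg+indeg v []            = refl
  deg≡outdeg+indeg v ((a , b) ∷ D) = begin
    touches v (a , b) + deg v D
      ≡⟨ cong (touches v (a , b) +_) (deg≡outdeg+indeg v D) ⟩
    ([ a ≐ v ] + [ b ≐ v ]) + (outdeg v D + indeg v D)
      ≡⟨ interchange [ a ≐ v ] [ b ≐ v ] (outdeg v D) (indeg v D) ⟩
    outdeg v ((a , b) ∷ D) + indeg v ((a , b) ∷ D) ∎
    where open ≡-Reasoning

  isArc : V → V → Arc → Bool
  isArc u w (a , b) = does (a ≟ u) ∧ does (b ≟ w)

  arc? : V → V → List Arc → Bool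
  arc? u w []      = false
  arc? u w (d ∷ D) = isArc u w d ∨ arc? u w D

  joins : V → V → Arc → Bool
  joins u w d = isArc u w d ∨ isArc w u d

  joined? : V → V → List Arc → Bool
  joined? u w []      = false
  joined? u w (d ∷ D) = joins u w d ∨ joined? u w D

  joined≡arc∨arc : ∀ u w D → joined? u w D ≡ arc? u w D ∨ arc? w u D
  joined≡arc∨arc u w []      = refl
  joined≡arc∨arc u w (d ∷ D) = begin
    joins u w d ∨ joined? u w D
      ≡⟨ cong (joins u w d ∨_) (joined≡arc∨arc u w D) ⟩
    (isArc u w d ∨ isArc w u d) ∨ (arc? u w D ∨ arc? w u D)
      ≡⟨ ∨-interchange (isArc u w d) (isArc w u d) (arc? u w D) (arc? w u D) ⟩
    arc? u w (d ∷ D) ∨ arc? w u (d ∷ D) ∎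
    where open ≡-Reasoning

  joined-sym : ∀ u w D → joined? u w D ≡ joined? w u D
  joined-sym u w []      = refl
  joined-sym u w (d ∷ D) = cong₂ _∨_ (∨-comm (isArc u w d) _) (joined-sym u w D)

  _≈_ : Arc → Arc → Set
  d ≈ e = d ≡ e ⊎ d ≡ swap e

  ≈-swap : ∀ {d e} → d ≈ e → swap d ≈ e
  ≈-swap (inj₁ refl) = inj₂ refl
  ≈-swap (inj₂ refl) = inj₁ refl

  touches-≈ : ∀ v {d e} → d ≈ e → touches v d ≡ touches v e
  touches-≈ v             (inj₁ refl) = refl
  touches-≈ v {e = a , b} (inj₂ refl) = +-comm [ b ≐ v ] [ a ≐ v ]

  joins-≈ : ∀ u w {d e} → d ≈ e → joins u w d ≡ joins u w e
  joins-≈ u w             (inj₁ refl) = refl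
  joins-≈ u w {e = a , b} (inj₂ refl) = begin
    (does (b ≟ u) ∧ does (a ≟ w)) ∨ (does (b ≟ w) ∧ does (a ≟ u))
      ≡⟨ cong₂ _∨_ (∧-comm (does (b ≟ u)) _) (∧-comm (does (b ≟ w)) _) ⟩
    isArc w u (a , b) ∨ isArc u w (a , b)
      ≡⟨ ∨-comm (isArc w u (a , b)) _ ⟩
    joins u w (a , b) ∎
    where open ≡-Reasoning

  Reorients : List Arc → List Arc → Set
  Reorients = Pointwise _≈_

  deg-reorient : ∀ v {D E} → Reorients D E → deg v D ≡ deg v E
  deg-reorient v []          = refl
  deg-reorient v (d≈e ∷ D~E) = cong₂ _+_ (touches-≈ v d≈e) (deg-reorient v D~E)

  joined-reorient : ∀ u w {D E} → Reorients D E → joined? u w D ≡ joined? u w E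
  joined-reorient u w []          = refl
  joined-reorient u w (d≈e ∷ D~E) = cong₂ _∨_ (joins-≈ u w d≈e) (joined-reorient u w D~E)

  split-reorients : ∀ P R {D} → Reorients D (P ++ R) →
                    ∃₂ λ P′ R′ → D ≡ P′ ++ R′ × Reorients P′ P × Reorients R′ R
  split-reorients []      R D~R = [] , _ , refl , [] , D~R
  split-reorients (p ∷ P) R (d≈p ∷ D~PR) with split-reorients P R D~PR
  ... | P′ , R′ , refl , P′~P , R′~R = _ ∷ P′ , R′ , refl , d≈p ∷ P′~P , R′~R

  Balanced : List Arc → Set
  Balanced D = ∀ v → outdeg v D ≤ suc (indeg v D)

  balanced-outdeg : ∀ {D} → Balanced D → ∀ v → 2 * outdeg v D ≤ suc (deg v D)
  balanced-outdeg {D} bal v = begin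
    outdeg v D + (outdeg v D + 0) ≡⟨ cong (outdeg v D +_) (+-identityʳ _) ⟩
    outdeg v D + outdeg v D       ≤⟨ +-monoʳ-≤ (outdeg v D) (bal v) ⟩
    outdeg v D + suc (indeg v D)  ≡⟨ +-suc (outdeg v D) _ ⟩
    suc (outdeg v D + indeg v D)  ≡⟨ cong suc (deg≡outdeg+indeg v D) ⟨
    suc (deg v D)                 ∎
    where open ≤-Reasoning

  balanced-middle : ∀ e P R → Balanced (e ∷ P ++ R) → Balanced (P ++ e ∷ R)
  balanced-middle e P R bal v
    rewrite occurrences-middle proj₁ v P e R | occurrences-middle proj₂ v P e R = bal v

  -- Subdividing the arc a → b at y into a → y → b adds one outgoing and one
  -- incoming arc at y and changes nothing else.
  balanced-subdivide : ∀ a b y L → Balanced ((a , b) ∷ L) → Balanced ((a , y) ∷ (y , b) ∷ L)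
  balanced-subdivide a b y L bal v = begin
    [ a ≐ v ] + ([ y ≐ v ] + outdeg v L)      ≡⟨ x∙yz≈y∙xz [ a ≐ v ] [ y ≐ v ] _ ⟩
    [ y ≐ v ] + ([ a ≐ v ] + outdeg v L)      ≤⟨ +-monoʳ-≤ [ y ≐ v ] (bal v) ⟩
    [ y ≐ v ] + suc ([ b ≐ v ] + indeg v L)   ≡⟨ +-suc [ y ≐ v ] _ ⟩
    suc ([ y ≐ v ] + ([ b ≐ v ] + indeg v L)) ∎
    where open ≤-Reasoning

  balanced-fresh-source : ∀ y x D → outdeg y D ≡ 0 → Balanced D → Balanced ((y , x) ∷ D)
  balanced-fresh-source y x D out₀ bal v with y ≟ v
  ... | yes refl rewrite out₀ = s≤s z≤n
  ... | no  _    = ≤-trans (bal v) (s≤s (m≤n+m (indeg v D) [ x ≐ v ]))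

  record Orientation (E : List Arc) : Set where
    constructor orientation
    field
      arcs      : List Arc
      reorients : Reorients arcs E
      balanced  : Balanced arcs

  data Incidence (y : V) : List Arc → Set where
    incident : ∀ P z f R → (y , z) ≈ f → Incidence y (P ++ f ∷ R)
    isolated : ∀ {E} → deg y E ≡ 0 → Incidence y E

  incidence : ∀ y E → Incidence y E
  incidence y [] = isolated refl
  incidence y (f@(a , b) ∷ E) with a ≟ y | b ≟ y
  ... | yes refl | _        = incident [] b f E (inj₁ refl)
  ... | no _     | yes refl = incident [] a f E (inj₂ refl)
  ... | no a≢y   | no b≢y   with incidence y E
  ...   | incident P z g R yz≈g = incident (f ∷ P) z g R yz≈g
  ...   | isolated deg₀         = isolated (begin
    [ a ≐ y ] + [ b ≐ y ] + deg y E
      ≡⟨ cong₂ (λ p q → ind p + ind q + deg y E)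
               (dec-false (a ≟ y) a≢y) (dec-false (b ≟ y) b≢y) ⟩
    deg y E
      ≡⟨ deg₀ ⟩
    0 ∎)
    where open ≡-Reasoning

  -- Gluing at y: when the edges x–y and f = y–z are replaced by the single
  -- edge x–z, an orientation of the shorter list yields one of the original
  -- list by subdividing the arc obtained for x–z at y again.
  glue : ∀ x y z P f R → (y , z) ≈ f →
         Orientation ((x , z) ∷ P ++ R) → Orientation ((x , y) ∷ P ++ f ∷ R)
  glue x y z P f R yz≈f (orientation (d ∷ D) (d≈xz ∷ D~PR) bal)
    with split-reorients P R D~PR
  ... | P′ , R′ , refl , P′~P , R′~R with d≈xz
  ...   | inj₁ refl = orientation ((x , y) ∷ P′ ++ (y , z) ∷ R′)
                        (inj₁ refl ∷ ++⁺ P′~P (yz≈f ∷ R′~R))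
                        (balanced-middle (y , z) ((x , y) ∷ P′) R′
                          (balanced-middle (x , y) ((y , z) ∷ []) (P′ ++ R′)
                            (balanced-subdivide x z y (P′ ++ R′) bal)))
  ...   | inj₂ refl = orientation ((y , x) ∷ P′ ++ (z , y) ∷ R′)
                        (inj₂ refl ∷ ++⁺ P′~P (≈-swap yz≈f ∷ R′~R))
                        (balanced-middle (z , y) ((y , x) ∷ P′) R′
                          (balanced-subdivide z x y (P′ ++ R′) bal))

  length-middle : ∀ (P : List Arc) f R → length (P ++ f ∷ R) ≡ suc (length (P ++ R))
  length-middle []      f R = refl
  length-middle (p ∷ P) f R = cong suc (length-middle P f R)

  -- If the second endpoint y of the first edge is isolated in the rest, the
  -- edge is oriented away from y; otherwise it is glued at y.
  orient-within : ∀ n E → length E ≤ n → Orientation E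
  orient-within n       []             _           = orientation [] [] (λ _ → z≤n)
  orient-within (suc n) ((x , y) ∷ E) (s≤s len≤n) with incidence y E
  ... | incident P z f R yz≈f =
    glue x y z P f R yz≈f (orient-within n ((x , z) ∷ P ++ R) shorter)
    where
    shorter : length ((x , z) ∷ P ++ R) ≤ n
    shorter = ≤-trans (≤-reflexive (sym (length-middle P f R))) len≤n
  ... | isolated deg₀ with orient-within n E len≤n
  ...   | orientation D D~E bal = orientation ((y , x) ∷ D) (inj₂ refl ∷ D~E)
    (balanced-fresh-source y x D (m+n≡0⇒m≡0 (outdeg y D) out+in≡0) bal)
    where
    out+in≡0 : outdeg y D + indeg y D ≡ 0
    out+in≡0 = trans (sym (deg≡outdeg+indeg y D)) (trans (deg-reorient y D~E) deg₀)

  orient : ∀ E → Orientation E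
  orient E = orient-within (length E) E ≤-refl

open module FinArcs {m : ℕ} = Arcs (_≟ᶠ_ {m})

restrict : ∀ {m} → Graph (suc m) → Graph m
restrict G = record
  { adj    = λ a b → adj G (suc a) (suc b)
  ; sym    = λ a b → Graph.sym G (suc a) (suc b)
  ; irrefl = λ v → irrefl G (suc v)
  }

sum-allFin-suc : ∀ {m} (f : Fin (suc m) → ℕ) →
                 sum (map f (allFin (suc m))) ≡ f zero + sum (map (f ∘ suc) (allFin m))
sum-allFin-suc f =
  cong sum (trans (map-tabulate id f) (cong (f zero ∷_) (sym (map-tabulate id (f ∘ suc)))))

degree-suc : ∀ {m} (G : Graph (suc m)) v →
             degree G v ≡ ind (adj G v zero) + sum (map (ind ∘ adj G v ∘ suc) (allFin m))
degree-suc G v = sum-allFin-suc (ind ∘ adj G v)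

select : ∀ {m} → (Fin m → Bool) → List (Fin m)
select {zero}  r = []
select {suc m} r =
  if r zero then zero ∷ map suc (select (r ∘ suc)) else map suc (select (r ∘ suc))

length-select : ∀ {m} (r : Fin m → Bool) → length (select r) ≡ sum (map (ind ∘ r) (allFin m))
length-select {zero}  r = refl
length-select {suc m} r = begin
  length (select r)
    ≡⟨ length-if (r zero) ⟩
  ind (r zero) + length S
    ≡⟨ cong (ind (r zero) +_)
            (trans (length-map {B = Fin (suc m)} suc (select (r ∘ suc))) (length-select (r ∘ suc))) ⟩
  ind (r zero) + sum (map (ind ∘ r ∘ suc) (allFin m))
    ≡⟨ sum-allFin-suc (ind ∘ r) ⟨
  sum (map (ind ∘ r) (allFin (suc m))) ∎
  where
  open ≡-Reasoning
  S : List (Fin (suc m))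
  S = map suc (select (r ∘ suc))
  length-if : ∀ b → length (if b then zero ∷ S else S) ≡ ind b + length S
  length-if true  = refl
  length-if false = refl

occurrences-suc : ∀ {m} (v : Fin m) S →
                  occurrences id (suc v) (map suc S) ≡ occurrences id v S
occurrences-suc v []      = refl
occurrences-suc v (b ∷ S) = cong ([ b ≐ v ] +_) (occurrences-suc v S)

occurrences-suc-zero : ∀ {m} (S : List (Fin m)) → occurrences id zero (map suc S) ≡ 0
occurrences-suc-zero []      = refl
occurrences-suc-zero (b ∷ S) = occurrences-suc-zero S

occurrences-select : ∀ {m} (r : Fin m → Bool) v → occurrences id v (select r) ≡ ind (r v)
occurrences-select {suc m} r zero with r zero
... | true  = cong suc (occurrences-suc-zero (select (r ∘ suc)))
... | false = occurrences-suc-zero (select (r ∘ suc))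
occurrences-select {suc m} r (suc v) with r zero
... | true  = trans (occurrences-suc v (select (r ∘ suc))) (occurrences-select (r ∘ suc) v)
... | false = trans (occurrences-suc v (select (r ∘ suc))) (occurrences-select (r ∘ suc) v)

spoke : ∀ {m} → Fin m → Fin (suc m) × Fin (suc m)
spoke b = zero , suc b

shift : ∀ {m} → Fin m × Fin m → Fin (suc m) × Fin (suc m)
shift (a , b) = suc a , suc b

-- The edge list of G: each edge once, as the arc from its smaller endpoint.
edges : ∀ {m} → Graph m → List (Fin m × Fin m)
edges {zero}  G = []
edges {suc m} G = map spoke (select (adj G zero ∘ suc)) ++ map shift (edges (restrict G))

deg-spokes-zero : ∀ {m} (S : List (Fin m)) L →
                  deg zero (map spoke S ++ L) ≡ length S + deg zero L
deg-spokes-zero []      L = refl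
deg-spokes-zero (b ∷ S) L = cong suc (deg-spokes-zero S L)

deg-spokes-suc : ∀ {m} (v : Fin m) S L →
                 deg (suc v) (map spoke S ++ L) ≡ occurrences id v S + deg (suc v) L
deg-spokes-suc v []      L = refl
deg-spokes-suc v (b ∷ S) L =
  trans (cong ([ b ≐ v ] +_) (deg-spokes-suc v S L)) (sym (+-assoc [ b ≐ v ] _ _))

deg-shift-zero : ∀ {m} (E : List (Fin m × Fin m)) → deg zero (map shift E) ≡ 0
deg-shift-zero []      = refl
deg-shift-zero (e ∷ E) = deg-shift-zero E

deg-shift-suc : ∀ {m} (v : Fin m) E → deg (suc v) (map shift E) ≡ deg v E
deg-shift-suc v []      = refl
deg-shift-suc v (e ∷ E) = cong (touches v e +_) (deg-shift-suc v E)

deg-edges : ∀ {m} (G : Graph m) v → deg v (edges G) ≡ degree G v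
deg-edges {suc m} G zero = begin
  deg zero (map spoke S ++ map shift E)   ≡⟨ deg-spokes-zero S _ ⟩
  length S + deg zero (map shift E)       ≡⟨ cong₂ _+_ (length-select r) (deg-shift-zero E) ⟩
  Σr + 0                                  ≡⟨ +-identityʳ Σr ⟩
  Σr                                      ≡⟨ cong (λ b → ind b + Σr) (irrefl G zero) ⟨
  ind (adj G zero zero) + Σr              ≡⟨ degree-suc G zero ⟨
  degree G zero                           ∎
  where
  open ≡-Reasoning
  r = adj G zero ∘ suc
  S = select r
  E = edges (restrict G)
  Σr = sum (map (ind ∘ r) (allFin m))
deg-edges {suc m} G (suc v) = begin
  deg (suc v) (map spoke S ++ map shift E)
    ≡⟨ deg-spokes-suc v S _ ⟩
  occurrences id v S + deg (suc v) (map shift E)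
    ≡⟨ cong₂ _+_ (occurrences-select r v) (trans (deg-shift-suc v E) (deg-edges (restrict G) v)) ⟩
  ind (adj G zero (suc v)) + degree (restrict G) v
    ≡⟨ cong (λ b → ind b + degree (restrict G) v) (Graph.sym G zero (suc v)) ⟩
  ind (adj G (suc v) zero) + degree (restrict G) v
    ≡⟨ degree-suc G (suc v) ⟨
  degree G (suc v) ∎
  where
  open ≡-Reasoning
  r = adj G zero ∘ suc
  S = select r
  E = edges (restrict G)

joined-spokes-zero-zero : ∀ {m} (S : List (Fin m)) L →
                          joined? zero zero (map spoke S ++ L) ≡ joined? zero zero L
joined-spokes-zero-zero []      L = refl
joined-spokes-zero-zero (b ∷ S) L = joined-spokes-zero-zero S L

joined-spokes-zero-suc : ∀ {m} (w : Fin m) S L →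
  joined? zero (suc w) (map spoke S ++ L) ≡ (0 <ᵇ occurrences id w S) ∨ joined? zero (suc w) L
joined-spokes-zero-suc w []      L = refl
joined-spokes-zero-suc w (b ∷ S) L with b ≟ᶠ w
... | yes _ = refl
... | no  _ = joined-spokes-zero-suc w S L

joined-spokes-suc : ∀ {m} (u w : Fin m) S L →
                    joined? (suc u) (suc w) (map spoke S ++ L) ≡ joined? (suc u) (suc w) L
joined-spokes-suc u w []      L = refl
joined-spokes-suc u w (b ∷ S) L = joined-spokes-suc u w S L

joined-shift-zero : ∀ {m} (w : Fin (suc m)) E → joined? zero w (map shift E) ≡ false
joined-shift-zero w []            = refl
joined-shift-zero w ((a , b) ∷ E) =
  cong₂ _∨_ (∧-zeroʳ (does (suc a ≟ᶠ w))) (joined-shift-zero w E)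

joined-shift-suc : ∀ {m} (u w : Fin m) E →
                   joined? (suc u) (suc w) (map shift E) ≡ joined? u w E
joined-shift-suc u w []      = refl
joined-shift-suc u w (e ∷ E) = cong (joins u w e ∨_) (joined-shift-suc u w E)

positive-ind : ∀ b → (0 <ᵇ ind b) ≡ b
positive-ind true  = refl
positive-ind false = refl

joined-edges : ∀ {m} (G : Graph m) u w → joined? u w (edges G) ≡ adj G u w
joined-edges {suc m} G zero zero = begin
  joined? zero zero (map spoke S ++ map shift E) ≡⟨ joined-spokes-zero-zero S _ ⟩
  joined? zero zero (map shift E)                ≡⟨ joined-shift-zero zero E ⟩
  false                                          ≡⟨ irrefl G zero ⟨
  adj G zero zero                                ∎
  where
  open ≡-Reasoning
  S = select (adj G zero ∘ suc)
  E = edges (restrict G)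
joined-edges {suc m} G zero (suc w) = begin
  joined? zero (suc w) (map spoke S ++ map shift E)
    ≡⟨ joined-spokes-zero-suc w S _ ⟩
  (0 <ᵇ occurrences id w S) ∨ joined? zero (suc w) (map shift E)
    ≡⟨ cong₂ _∨_ in-S (joined-shift-zero (suc w) E) ⟩
  adj G zero (suc w) ∨ false
    ≡⟨ ∨-identityʳ _ ⟩
  adj G zero (suc w) ∎
  where
  open ≡-Reasoning
  S = select (adj G zero ∘ suc)
  E = edges (restrict G)
  in-S : (0 <ᵇ occurrences id w S) ≡ adj G zero (suc w)
  in-S = trans (cong (0 <ᵇ_) (occurrences-select (adj G zero ∘ suc) w)) (positive-ind _)
joined-edges {suc m} G (suc u) zero =
  trans (joined-sym (suc u) zero (edges G))
        (trans (joined-edges G zero (suc u)) (Graph.sym G zero (suc u)))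
joined-edges {suc m} G (suc u) (suc w) =
  trans (joined-spokes-suc u w (select (adj G zero ∘ suc)) _)
    (trans (joined-shift-suc u w (edges (restrict G))) (joined-edges (restrict G) u w))

nth : {A : Set} → A → ℕ → List A → A
nth d t       []       = d
nth d zero    (x ∷ xs) = x
nth d (suc t) (x ∷ xs) = nth d t xs

∈⇒nth : {A : Set} {x : A} (d : A) (xs : List A) → x ∈ xs →
        ∃ λ t → t < length xs × nth d t xs ≡ x
∈⇒nth d (x ∷ xs) (here refl) = 0 , s≤s z≤n , refl
∈⇒nth d (y ∷ xs) (there x∈xs) with ∈⇒nth d xs x∈xs
... | t , t<len , eq = suc t , s≤s t<len , eq

ones : List Bool → ℕ
ones []      = 0
ones (b ∷ l) = ind b + ones l

set : ℕ → List Bool → List Bool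
set i       []      = []
set zero    (b ∷ l) = true ∷ l
set (suc i) (b ∷ l) = b ∷ set i l

length-set : ∀ i l → length (set i l) ≡ length l
length-set i       []      = refl
length-set zero    (b ∷ l) = refl
length-set (suc i) (b ∷ l) = cong suc (length-set i l)

ones-set : ∀ i l → ones (set i l) ≤ suc (ones l)
ones-set i       []          = z≤n
ones-set zero    (true  ∷ l) = n≤1+n _
ones-set zero    (false ∷ l) = ≤-refl
ones-set (suc i) (b ∷ l)     =
  ≤-trans (+-monoʳ-≤ (ind b) (ones-set i l)) (≤-reflexive (+-suc (ind b) (ones l)))

nth-set : ∀ i j l → i < length l → nth false j (set i l) ≡ (i ≡ᵇ j) ∨ nth false j l
nth-set zero    zero    (b ∷ l) _         = refl
nth-set zero    (suc j) (b ∷ l) _         = refl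
nth-set (suc i) zero    (b ∷ l) _         = refl
nth-set (suc i) (suc j) (b ∷ l) (s≤s i<l) = nth-set i j l i<l

nth-replicate : ∀ n j → nth false j (replicate n false) ≡ false
nth-replicate zero    j       = refl
nth-replicate (suc n) zero    = refl
nth-replicate (suc n) (suc j) = nth-replicate n j

ones-replicate : ∀ n → ones (replicate n false) ≡ 0
ones-replicate zero    = refl
ones-replicate (suc n) = ones-replicate n

toℕ-≡ᵇ : ∀ {m} (a b : Fin m) → (toℕ a ≡ᵇ toℕ b) ≡ does (a ≟ᶠ b)
toℕ-≡ᵇ zero    zero    = refl
toℕ-≡ᵇ zero    (suc b) = refl
toℕ-≡ᵇ (suc a) zero    = refl
toℕ-≡ᵇ (suc a) (suc b) = toℕ-≡ᵇ a b

row : ∀ {m} → ℕ → Fin m → List (Fin m × Fin m) → List Bool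
row n v []            = replicate n false
row n v ((a , b) ∷ D) = if does (a ≟ᶠ v) then set (toℕ b) (row n v D) else row n v D

length-row : ∀ {m} n (v : Fin m) D → length (row n v D) ≡ n
length-row n v []            = length-replicate n
length-row n v ((a , b) ∷ D) with does (a ≟ᶠ v)
... | true  = trans (length-set (toℕ b) (row n v D)) (length-row n v D)
... | false = length-row n v D

ones-row : ∀ {m} n (v : Fin m) D → ones (row n v D) ≤ outdeg v D
ones-row n v []            = ≤-reflexive (ones-replicate n)
ones-row n v ((a , b) ∷ D) with does (a ≟ᶠ v)
... | true  = ≤-trans (ones-set (toℕ b) (row n v D)) (s≤s (ones-row n v D))
... | false = ones-row n v D

nth-row : ∀ {m n} → m ≤ n → ∀ (v w : Fin m) D → nth false (toℕ w) (row n v D) ≡ arc? v w D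
nth-row {n = n} m≤n v w [] = nth-replicate n (toℕ w)
nth-row {n = n} m≤n v w ((a , b) ∷ D) with does (a ≟ᶠ v)
... | true  = trans (nth-set (toℕ b) (toℕ w) (row n v D) b<len)
                (cong₂ _∨_ (toℕ-≡ᵇ b w) (nth-row m≤n v w D))
  where
  b<len : toℕ b < length (row n v D)
  b<len = ≤-trans (toℕ<n b) (≤-trans m≤n (≤-reflexive (sym (length-row n v D))))
... | false = nth-row m≤n v w D

patterns : ℕ → ℕ → List (List Bool)
patterns zero    c       = [] ∷ []
patterns (suc n) zero    = map (false ∷_) (patterns n zero)
patterns (suc n) (suc c) = map (false ∷_) (patterns n (suc c)) ++ map (true ∷_) (patterns n c)

∈-patterns : ∀ l c → ones l ≤ c → l ∈ patterns (length l) c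
∈-patterns []          c       _            = here refl
∈-patterns (false ∷ l) zero    ones≤c       = ∈-map⁺ (false ∷_) (∈-patterns l zero ones≤c)
∈-patterns (false ∷ l) (suc c) ones≤c       = ∈-++⁺ˡ (∈-map⁺ (false ∷_) (∈-patterns l (suc c) ones≤c))
∈-patterns (true  ∷ l) (suc c) (s≤s ones≤c) = ∈-++⁺ʳ _ (∈-map⁺ (true ∷_) (∈-patterns l c ones≤c))

binom : ℕ → ℕ → ℕ
binom n       zero    = 1
binom zero    (suc j) = 0
binom (suc n) (suc j) = binom n j + binom n (suc j)

binom≡C : ∀ n j → binom n j ≡ n C j
binom≡C n       zero    = refl
binom≡C zero    (suc j) = refl
binom≡C (suc n) (suc j) =
  trans (cong₂ _+_ (binom≡C n j) (binom≡C n (suc j))) (nCk+nC[k+1]≡[n+1]C[k+1] n j)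

binomSum : ℕ → ℕ → ℕ
binomSum n zero    = 1
binomSum n (suc c) = binomSum n c + binom n (suc c)

binomSum-zero : ∀ c → binomSum 0 c ≡ 1
binomSum-zero zero    = refl
binomSum-zero (suc c) = trans (+-identityʳ (binomSum 0 c)) (binomSum-zero c)

binomSum-pascal : ∀ n c → binomSum (suc n) (suc c) ≡ binomSum n (suc c) + binomSum n c
binomSum-pascal n zero    = +-comm 1 (1 + binom n 1)
binomSum-pascal n (suc c) = begin
  binomSum (suc n) (suc c) + (binom n (suc c) + binom n (suc (suc c)))
    ≡⟨ cong (_+ (binom n (suc c) + binom n (suc (suc c)))) (binomSum-pascal n c) ⟩
  (binomSum n (suc c) + binomSum n c) + (binom n (suc c) + binom n (suc (suc c)))
    ≡⟨ solve 4 (λ a s b d → (a :+ s) :+ (b :+ d) := (a :+ d) :+ (s :+ b)) refl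
         (binomSum n (suc c)) (binomSum n c) (binom n (suc c)) (binom n (suc (suc c))) ⟩
  binomSum n (suc (suc c)) + binomSum n (suc c) ∎
  where
  open ≡-Reasoning
  open +-*-Solver

length-patterns : ∀ n c → length (patterns n c) ≡ binomSum n c
length-patterns zero    c       = sym (binomSum-zero c)
length-patterns (suc n) zero    =
  trans (length-map (false ∷_) (patterns n zero)) (length-patterns n zero)
length-patterns (suc n) (suc c) = begin
  length (map (false ∷_) (patterns n (suc c)) ++ map (true ∷_) (patterns n c))
    ≡⟨ length-++ (map (false ∷_) (patterns n (suc c))) ⟩
  length (map (false ∷_) (patterns n (suc c))) + length (map (true ∷_) (patterns n c))
    ≡⟨ cong₂ _+_ (trans (length-map (false ∷_) (patterns n (suc c))) (length-patterns n (suc c)))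
                 (trans (length-map (true ∷_) (patterns n c)) (length-patterns n c)) ⟩
  binomSum n (suc c) + binomSum n c
    ≡⟨ binomSum-pascal n c ⟨
  binomSum (suc n) (suc c) ∎
  where open ≡-Reasoning

pattern-index : ∀ n c l → length l ≡ n → ones l ≤ c →
                ∃ λ t → t < binomSum n c × nth [] t (patterns n c) ≡ l
pattern-index _ c l refl ones≤c with ∈⇒nth [] _ (∈-patterns l c ones≤c)
... | t , t<len , eq = t , subst (t <_) (length-patterns (length l) c) t<len , eq

-- (j+1)·C(n,j+1) = (n-j)·C(n,j), in subtraction-free form.
binom-ratio : ∀ n j → suc j * binom n (suc j) + j * binom n j ≡ n * binom n j
binom-ratio zero    zero    = refl
binom-ratio zero    (suc j) = cong₂ _+_ (*-zeroʳ (suc (suc j))) (*-zeroʳ (suc j))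
binom-ratio (suc n) zero    =
  trans (solve 1 (λ x → con 1 :* (con 1 :+ x) :+ con 0 := con 1 :+ (con 1 :* x :+ con 0))
                 refl (binom n 1))
        (cong suc (binom-ratio n zero))
  where open +-*-Solver
binom-ratio (suc n) (suc j) = begin
    suc (suc j) * (b + c) + suc j * (a + b)
  ≡⟨ solve 4 (λ J a b c → (con 2 :+ J) :* (b :+ c) :+ (con 1 :+ J) :* (a :+ b)
                        := ((con 2 :+ J) :* c :+ (con 1 :+ J) :* b)
                           :+ ((con 2 :+ J) :* b :+ (con 1 :+ J) :* a))
       refl j a b c ⟩
    (suc (suc j) * c + suc j * b) + (suc (suc j) * b + suc j * a)
  ≡⟨ cong (_+ (suc (suc j) * b + suc j * a)) (binom-ratio n (suc j)) ⟩
    n * b + (suc (suc j) * b + suc j * a)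
  ≡⟨ cong (n * b +_) (solve 3 (λ J a b → (con 2 :+ J) :* b :+ (con 1 :+ J) :* a
                                      := b :+ a :+ ((con 1 :+ J) :* b :+ J :* a)) refl j a b) ⟩
    n * b + (b + a + (suc j * b + j * a))
  ≡⟨ cong (λ x → n * b + (b + a + x)) (binom-ratio n j) ⟩
    n * b + (b + a + n * a)
  ≡⟨ solve 3 (λ a b N → N :* b :+ (b :+ a :+ N :* a) := (con 1 :+ N) :* (a :+ b)) refl a b n ⟩
    suc n * (a + b)
  ∎
  where
  open ≡-Reasoning
  open +-*-Solver
  a = binom n j
  b = binom n (suc j)
  c = binom n (suc (suc j))

binom-mono : ∀ n j → suc (2 * j) ≤ n → binom n j ≤ binom n (suc j)
binom-mono n j 2j<n = *-cancelˡ-≤ (suc j) (+-cancelʳ-≤ (j * binom n j) _ _ (begin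
  suc j * binom n j + j * binom n j   ≡⟨ *-distribʳ-+ (binom n j) (suc j) j ⟨
  (suc j + j) * binom n j             ≡⟨ cong (λ x → suc (j + x) * binom n j) (+-identityʳ j) ⟨
  suc (2 * j) * binom n j             ≤⟨ *-monoˡ-≤ (binom n j) 2j<n ⟩
  n * binom n j                       ≡⟨ binom-ratio n j ⟨
  suc j * binom n (suc j) + j * binom n j ∎))
  where open ≤-Reasoning

binomSum-bound : ∀ n c → 2 * c ≤ suc n → binomSum n c ≤ suc c * binom n c
binomSum-bound n zero    _     = s≤s z≤n
binomSum-bound n (suc c) 2c≤n₁ = begin
  binomSum n c + binom n (suc c)
    ≤⟨ +-monoˡ-≤ _ (binomSum-bound n c (≤-trans (*-monoʳ-≤ 2 (n≤1+n c)) 2c≤n₁)) ⟩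
  suc c * binom n c + binom n (suc c)
    ≤⟨ +-monoˡ-≤ _ (*-monoʳ-≤ (suc c) (binom-mono n c 2c<n)) ⟩
  suc c * binom n (suc c) + binom n (suc c)
    ≡⟨ +-comm (suc c * binom n (suc c)) _ ⟩
  suc (suc c) * binom n (suc c) ∎
  where
  open ≤-Reasoning
  2c<n : suc (2 * c) ≤ n
  2c<n = ≤-pred (≤-trans (≤-reflexive (sym (*-suc 2 c))) 2c≤n₁)

-- Labels read as numbers in bijective base 2: the lists of length at most s
-- represent exactly the numbers x with x + 1 < 2 ^ (s + 1).
value : List Bool → ℕ
value []      = 0
value (b ∷ l) = suc (ind b + 2 * value l)

last-digit : ∀ x → x ≡ 0 ⊎ ∃₂ λ b y → x ≡ suc (ind b + 2 * y)
last-digit zero = inj₁ refl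
last-digit (suc x) with last-digit x
... | inj₁ refl                = inj₂ (false , 0 , refl)
... | inj₂ (false , y , refl)  = inj₂ (true , y , refl)
... | inj₂ (true  , y , refl)  = inj₂ (false , suc y , cong suc (sym (*-suc 2 y)))

label-exists : ∀ s x → suc x < 2 ^ suc s → ∃ λ l → length l ≤ s × value l ≡ x
label-exists s x x<2^s₁ with last-digit x
... | inj₁ refl = [] , z≤n , refl
label-exists zero    _ (s≤s (s≤s ())) | inj₂ (b , y , refl)
label-exists (suc s) _ x<2^s₁         | inj₂ (b , y , refl)
  with label-exists s y (*-cancelˡ-< 2 (suc y) (2 ^ suc s) (≤-<-trans 2[y+1]≤x+1 x<2^s₁))
  where
  2[y+1]≤x+1 : 2 * suc y ≤ suc (suc (ind b + 2 * y))
  2[y+1]≤x+1 = ≤-trans (≤-reflexive (*-suc 2 y)) (s≤s (s≤s (m≤n+m (2 * y) (ind b))))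
... | l , len≤s , refl = b ∷ l , s≤s len≤s , refl

pair-% : ∀ {n} .{{_ : NonZero n}} i t → i < n → (i + t * n) % n ≡ i
pair-% {n} i t i<n = trans ([m+kn]%n≡m%n i t n) (m<n⇒m%n≡m i<n)

pair-/ : ∀ {n} .{{_ : NonZero n}} i t → i < n → (i + t * n) / n ≡ t
pair-/ {n} i t i<n =
  trans (+-distrib-/-∣ʳ i (divides t refl)) (cong₂ _+_ (m<n⇒m/n≡0 i<n) (m*n/n≡m t n))

2*⌈k/2⌉≤k+1 : ∀ k → 2 * ⌈ k /2⌉ ≤ k + 1
2*⌈k/2⌉≤k+1 k = ≤-trans (≤-reflexive (*-comm 2 ⌈ k /2⌉)) (m/n*n≤m (k + 1) 2)

≤⌈k/2⌉ : ∀ k o → 2 * o ≤ k + 1 → o ≤ ⌈ k /2⌉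
≤⌈k/2⌉ k o 2o≤k+1 = ≤-trans (≤-reflexive (sym (m*n/n≡m o 2)))
                      (/-monoˡ-≤ 2 (≤-trans (≤-reflexive (*-comm o 2)) 2o≤k+1))

⌈k/2⌉<k : ∀ k → 2 ≤ k → ⌈ k /2⌉ < k
⌈k/2⌉<k k 2≤k = m<n*o⇒m/o<n (begin-strict
  k + 1       <⟨ +-monoʳ-< k 2≤k ⟩
  k + k       ≡⟨ cong (k +_) (+-identityʳ k) ⟨
  2 * k       ≡⟨ *-comm 2 k ⟩
  k * 2       ∎)
  where open ≤-Reasoning

-- n ≤ 2 ^ ⌈log₂ n⌉, along the recursion ⌈log₂ (n+2)⌉ = 1 + ⌈log₂ (1 + ⌈n/2⌉)⌉.
≤2^⌈log2⌉ : ∀ n (rec : Acc _<_ n) → n ≤ 2 ^ ⌈log2⌉ n rec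
≤2^⌈log2⌉ zero          _        = z≤n
≤2^⌈log2⌉ (suc zero)    _        = s≤s z≤n
≤2^⌈log2⌉ (suc (suc n)) (acc rs) = begin
  2 + n           ≤⟨ +-monoʳ-≤ 2 n≤h+h ⟩
  2 + (h + h)     ≡⟨ cong (λ x → 2 + (h + x)) (+-identityʳ h) ⟨
  2 + 2 * h       ≡⟨ *-suc 2 h ⟨
  2 * suc h       ≤⟨ *-monoʳ-≤ 2 (≤2^⌈log2⌉ (suc h) (rs (⌈n/2⌉<n n))) ⟩
  2 * 2 ^ ⌈log2⌉ (suc h) (rs (⌈n/2⌉<n n)) ∎
  where
  open ≤-Reasoning
  h = ⌈ n /2⌉ᴺ
  n≤h+h : n ≤ h + h
  n≤h+h = ≤-trans (≤-reflexive (sym (⌊n/2⌋+⌈n/2⌉≡n n))) (+-monoˡ-≤ h (⌊n/2⌋≤⌈n/2⌉ n))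

n≤2^⌈log₂n⌉ : ∀ n → n ≤ 2 ^ ⌈log₂ n ⌉
n≤2^⌈log₂n⌉ n = ≤2^⌈log2⌉ n _

-- n < 2 ^ (1 + ⌊log₂ n⌋), since otherwise ⌊log₂⌋ would exceed itself.
n<2^[1+⌊log₂n⌋] : ∀ n → n < 2 ^ suc ⌊log₂ n ⌋
n<2^[1+⌊log₂n⌋] n = ≰⇒> λ 2^[1+l]≤n →
  1+n≰n (≤-trans (≤-reflexive (sym (⌊log₂[2^n]⌋≡n (suc ⌊log₂ n ⌋))))
                 (⌊log₂⌋-mono-≤ 2^[1+l]≤n))

2^[1+a+b+c] : ∀ a b c → 2 ^ suc (a + b + c) ≡ 2 ^ suc a * (2 ^ b * 2 ^ c)
2^[1+a+b+c] a b c = begin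
  2 ^ (suc a + b + c)           ≡⟨ ^-distribˡ-+-* 2 (suc a + b) c ⟩
  2 ^ (suc a + b) * 2 ^ c       ≡⟨ cong (_* 2 ^ c) (^-distribˡ-+-* 2 (suc a) b) ⟩
  2 ^ suc a * 2 ^ b * 2 ^ c     ≡⟨ *-assoc (2 ^ suc a) (2 ^ b) (2 ^ c) ⟩
  2 ^ suc a * (2 ^ b * 2 ^ c)   ∎
  where open ≡-Reasoning

-- For 2 ≤ k ≤ n the n · binomSum n ⌈k/2⌉ pairs (vertex, row) fit into the labels
-- of length at most schemeSize n k:  binomSum n c ≤ (c+1)·C(n,c) ≤ k·C(n,c).
room-general : ∀ n k → 2 ≤ k → k ≤ n → n * binomSum n ⌈ k /2⌉ < 2 ^ suc (schemeSize n k)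
room-general n@(suc _) k@(suc (suc _)) 2≤k k≤n = begin-strict
  n * binomSum n c            ≤⟨ *-monoʳ-≤ n (binomSum-bound n c 2c≤n+1) ⟩
  n * (suc c * binom n c)     ≤⟨ *-monoʳ-≤ n (*-monoˡ-≤ (binom n c) (⌈k/2⌉<k k 2≤k)) ⟩
  n * (k * binom n c)         ≡⟨ cong (λ x → n * (k * x)) (binom≡C n c) ⟩
  n * (k * N)                 ≡⟨ *-assoc n k N ⟨
  n * k * N                   ≡⟨ *-comm (n * k) N ⟩
  N * (n * k)                 <⟨ *-monoˡ-< (n * k) (n<2^[1+⌊log₂n⌋] N) ⟩
  2 ^ suc ⌊log₂ N ⌋ * (n * k)
    ≤⟨ *-monoʳ-≤ (2 ^ suc ⌊log₂ N ⌋) (*-mono-≤ (n≤2^⌈log₂n⌉ n) (n≤2^⌈log₂n⌉ k)) ⟩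
  2 ^ suc ⌊log₂ N ⌋ * (2 ^ ⌈log₂ n ⌉ * 2 ^ ⌈log₂ k ⌉)
    ≡⟨ 2^[1+a+b+c] ⌊log₂ N ⌋ ⌈log₂ n ⌉ ⌈log₂ k ⌉ ⟨
  2 ^ suc (schemeSize n k) ∎
  where
  open ≤-Reasoning
  c = ⌈ k /2⌉
  N = n C c
  2c≤n+1 : 2 * c ≤ suc n
  2c≤n+1 = ≤-trans (2*⌈k/2⌉≤k+1 k) (≤-trans (≤-reflexive (+-comm k 1)) (s≤s k≤n))
room-general _ (suc zero) (s≤s ()) _

-- For k = 1: either n < 2^⌈log₂n⌉, or n is a power of two and ⌊log₂n⌋ = ⌈log₂n⌉.
n[n+1]<2^[1+⌊log₂n⌋+⌈log₂n⌉] : ∀ n → 2 ≤ n →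
                                n * suc n < 2 ^ suc ⌊log₂ n ⌋ * 2 ^ ⌈log₂ n ⌉
n[n+1]<2^[1+⌊log₂n⌋+⌈log₂n⌉] n 2≤n with m≤n⇒m<n∨m≡n (n≤2^⌈log₂n⌉ n)
... | inj₁ n<2^g = begin-strict
  n * suc n
    ≤⟨ *-monoʳ-≤ n n<2^g ⟩
  n * 2 ^ ⌈log₂ n ⌉
    <⟨ *-monoˡ-< (2 ^ ⌈log₂ n ⌉) {{m^n≢0 2 ⌈log₂ n ⌉}} (n<2^[1+⌊log₂n⌋] n) ⟩
  2 ^ suc ⌊log₂ n ⌋ * 2 ^ ⌈log₂ n ⌉ ∎
  where open ≤-Reasoning
... | inj₂ n≡2^g = begin-strict
  n * suc n
    <⟨ *-monoʳ-< n {{>-nonZero (≤-trans (s≤s z≤n) 2≤n)}} n+1<2n ⟩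
  n * (2 * n)
    ≡⟨ *-comm n (2 * n) ⟩
  2 * n * n
    ≡⟨ cong (λ x → 2 * x * x) n≡2^g ⟩
  2 * 2 ^ ⌈log₂ n ⌉ * 2 ^ ⌈log₂ n ⌉
    ≡⟨ cong (λ e → 2 * 2 ^ e * 2 ^ ⌈log₂ n ⌉) ⌊log₂n⌋≡⌈log₂n⌉ ⟨
  2 ^ suc ⌊log₂ n ⌋ * 2 ^ ⌈log₂ n ⌉ ∎
  where
  open ≤-Reasoning
  ⌊log₂n⌋≡⌈log₂n⌉ : ⌊log₂ n ⌋ ≡ ⌈log₂ n ⌉
  ⌊log₂n⌋≡⌈log₂n⌉ = trans (cong ⌊log₂_⌋ n≡2^g) (⌊log₂[2^n]⌋≡n ⌈log₂ n ⌉)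
  n+1<2n : suc n < 2 * n
  n+1<2n = ≤-trans (+-monoˡ-≤ n 2≤n) (≤-reflexive (cong (n +_) (sym (+-identityʳ n))))

room-one : ∀ n → 2 ≤ n → n * binomSum n ⌈ 1 /2⌉ < 2 ^ suc (schemeSize n 1)
room-one n 2≤n = begin-strict
  n * (1 + binom n 1)
    ≡⟨ cong (λ x → n * suc x) (trans (binom≡C n 1) (nC1≡n n)) ⟩
  n * suc n
    <⟨ n[n+1]<2^[1+⌊log₂n⌋+⌈log₂n⌉] n 2≤n ⟩
  2 ^ suc ⌊log₂ n ⌋ * 2 ^ ⌈log₂ n ⌉
    ≡⟨ cong (λ x → 2 ^ suc ⌊log₂ x ⌋ * 2 ^ ⌈log₂ n ⌉) (nC1≡n n) ⟨
  2 ^ suc ⌊log₂ (n C 1) ⌋ * 2 ^ ⌈log₂ n ⌉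
    ≡⟨ cong (2 ^ suc ⌊log₂ (n C 1) ⌋ *_) (*-identityʳ _) ⟨
  2 ^ suc ⌊log₂ (n C 1) ⌋ * (2 ^ ⌈log₂ n ⌉ * 2 ^ ⌈log₂ 1 ⌉)
    ≡⟨ 2^[1+a+b+c] ⌊log₂ (n C 1) ⌋ ⌈log₂ n ⌉ ⌈log₂ 1 ⌉ ⟨
  2 ^ suc (schemeSize n 1) ∎
  where open ≤-Reasoning

-- With at most one vertex there are no edges, and empty labels suffice.
scheme-one-vertex : ∀ k s → HasLabelingScheme 1 k s
scheme-one-vertex k s = (λ _ _ → false) , λ
  { zero          _           G _ → (λ _ → []) , (λ ()) , (λ ())
  ; (suc zero)    _           G _ →
      (λ _ → []) , (λ _ → z≤n) , λ { zero zero → sym (irrefl G zero) }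
  ; (suc (suc m)) (s≤s ())    G _
  }

-- The label of v codes v + t·n, where the out-row of v in
-- a balanced orientation of G is the t-th pattern.
module Construction (n k s : ℕ) .{{_ : NonZero n}}
                    (room : n * binomSum n ⌈ k /2⌉ < 2 ^ suc s) where

  c : ℕ
  c = ⌈ k /2⌉

  -- The row of the vertex labelled l, read at the vertex labelled l′.
  bit : Label → Label → Bool
  bit l l′ = nth false (value l′ % n) (nth [] (value l / n) (patterns n c))

  decode : Label → Label → Bool
  decode l l′ = bit l l′ ∨ bit l′ l

  module Encoding {m} (m≤n : m ≤ n) (G : Graph m) (Δ≤k : MaxDegreeAtMost k G) where

    open Orientation (orient (edges G)) renaming (arcs to D)

    outdeg≤c : ∀ v → outdeg v D ≤ c
    outdeg≤c v = ≤⌈k/2⌉ k (outdeg v D) (begin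
      2 * outdeg v D     ≤⟨ balanced-outdeg {D = D} balanced v ⟩
      suc (deg v D)      ≡⟨ cong suc (trans (deg-reorient v reorients) (deg-edges G v)) ⟩
      suc (degree G v)   ≤⟨ s≤s (Δ≤k v) ⟩
      suc k              ≡⟨ +-comm 1 k ⟩
      k + 1              ∎)
      where open ≤-Reasoning

    row-pattern : ∀ v → ∃ λ t → t < binomSum n c × nth [] t (patterns n c) ≡ row n v D
    row-pattern v =
      pattern-index n c (row n v D) (length-row n v D) (≤-trans (ones-row n v D) (outdeg≤c v))

    index : Fin m → ℕ
    index v = proj₁ (row-pattern v)

    v<n : ∀ (v : Fin m) → toℕ v < n
    v<n v = ≤-trans (toℕ<n v) m≤n

    code : Fin m → ℕ
    code v = toℕ v + index v * n

    code< : ∀ v → code v < n * binomSum n c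
    code< v = begin-strict
      toℕ v + index v * n  <⟨ +-monoˡ-< (index v * n) (v<n v) ⟩
      suc (index v) * n    ≤⟨ *-monoˡ-≤ n (proj₁ (proj₂ (row-pattern v))) ⟩
      binomSum n c * n     ≡⟨ *-comm (binomSum n c) n ⟩
      n * binomSum n c     ∎
      where open ≤-Reasoning

    labelling : ∀ v → ∃ λ l → length l ≤ s × value l ≡ code v
    labelling v = label-exists s (code v) (≤-<-trans (code< v) room)

    label : Fin m → Label
    label v = proj₁ (labelling v)

    column : ∀ v → value (label v) % n ≡ toℕ v
    column v = trans (cong (_% n) (proj₂ (proj₂ (labelling v)))) (pair-% (toℕ v) (index v) (v<n v))

    line : ∀ v → value (label v) / n ≡ index v
    line v = trans (cong (_/ n) (proj₂ (proj₂ (labelling v)))) (pair-/ (toℕ v) (index v) (v<n v))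

    bit-correct : ∀ u w → bit (label u) (label w) ≡ arc? u w D
    bit-correct u w = begin
      nth false (value (label w) % n) (nth [] (value (label u) / n) (patterns n c))
        ≡⟨ cong₂ (λ i t → nth false i (nth [] t (patterns n c))) (column w) (line u) ⟩
      nth false (toℕ w) (nth [] (index u) (patterns n c))
        ≡⟨ cong (nth false (toℕ w)) (proj₂ (proj₂ (row-pattern u))) ⟩
      nth false (toℕ w) (row n u D)
        ≡⟨ nth-row m≤n u w D ⟩
      arc? u w D ∎
      where open ≡-Reasoning

    decode-correct : ∀ u w → decode (label u) (label w) ≡ adj G u w
    decode-correct u w = begin
      bit (label u) (label w) ∨ bit (label w) (label u)
        ≡⟨ cong₂ _∨_ (bit-correct u w) (bit-correct w u) ⟩
      arc? u w D ∨ arc? w u D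
        ≡⟨ joined≡arc∨arc u w D ⟨
      joined? u w D
        ≡⟨ joined-reorient u w reorients ⟩
      joined? u w (edges G)
        ≡⟨ joined-edges G u w ⟩
      adj G u w ∎
      where open ≡-Reasoning

  scheme : HasLabelingScheme n k s
  scheme = decode , λ m m≤n G Δ≤k → let open Encoding m≤n G Δ≤k in
    label , (λ v → proj₁ (proj₂ (labelling v))) , decode-correct

theorem3 : (n k : ℕ) → 1 ≤ k → k ≤ n → HasLabelingScheme n k (schemeSize n k)
theorem3 n@(suc _) k@(suc (suc _)) _ k≤n =
  Construction.scheme n k (schemeSize n k) (room-general n k (s≤s (s≤s z≤n)) k≤n)
theorem3 n@(suc (suc _)) 1 _ _ =
  Construction.scheme n 1 (schemeSize n 1) (room-one n (s≤s (s≤s z≤n)))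
theorem3 1 1 _ _ = scheme-one-vertex 1 (schemeSize 1 1)
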